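{- Let $k$ be a Sierpiński number constructed using the covering system method, i.e. $k$ is an odd positive integer for which there exist a covering system $\{r_j\pmod{m_j}:1\le j\le\tau\}$ and distinct primes $p_1,\dots,p_\tau$ with $p_j\mid 2^{m_j}-1$, such that $k\equiv -2^{ -r_j}\pmod{p_j}$ and $k\cdot 2^n+1>p_j$ for all $1\le j\le\tau$ and all positive integers $n$. Then for every integer $b\ge2$ there exist infinitely many positive integers $t$ such that the $b$-repinteger $k_b^{(t)}$ is a Sierpiński number.
   Context: A covering system of the integers is a finite collection of congruences $r_j \pmod{m_j}$ such that every integer satisfies at least one of them. $2^{ -r}\pmod p$ denotes the inverse of $2^r$ modulo the odd prime $p$. A Sierpiński number is an odd positive integer $k$ such that $k\cdot 2^n+1$ is composite for all positive integers $n$. For integers $b\ge2$, $k\ge1$, $t\ge1$, the $b$-repinteger is $k_b^{(t)}=k\,(b^{\ell t}-1)/(b^\ell-1)$ where $\ell=\lfloor\log_b k\rfloor+1$ is the number of base-$b$ digits of $k$ (i.e. the base-$b$ representation of $k$ written $t$ times in a row). -}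

module Defs where

open import Data.Nat using (ℕ; zero; suc; _+_; _*_; _∸_; _^_; _≤_; _<_; _<?_)
open import Data.Nat.Primality using (Composite)
open import Data.Bool using (if_then_else_)
open import Relation.Nullary.Decidable using (⌊_⌋)

Odd : ℕ → Set
Odd k = Data.Nat._%_ k 2 Relation.Binary.PropositionalEquality.≡ 1
  where open import Relation.Binary.PropositionalEquality

Sierpinski : ℕ → Set
Sierpinski k = Odd k × (1 ≤ k) × ((n : ℕ) → 1 ≤ n → Composite (k * 2 ^ n + 1))
  where open import Data.Product using (_×_)

-- number of base-b digits of k (k ≥ 1, b ≥ 2): the least ℓ ≥ 1 with k < b^ℓ,
-- i.e. ⌊log_b k⌋ + 1.  Search with fuel k + 1 (enough since k < b^(k+1)).
digitsSearch : ℕ → ℕ → ℕ → ℕ → ℕ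
digitsSearch b k ℓ zero     = ℓ
digitsSearch b k ℓ (suc f) = if ⌊ k <? b ^ ℓ ⌋ then ℓ else digitsSearch b k (suc ℓ) f

numDigits : ℕ → ℕ → ℕ
numDigits b k = digitsSearch b k 1 (suc k)

geomSum : ℕ → ℕ → ℕ
geomSum x zero    = 0
geomSum x (suc t) = geomSum x t + x ^ t

-- b-repinteger k_b^(t) = k (b^(ℓt) - 1)/(b^ℓ - 1) = k · Σ_{i<t} (b^ℓ)^i,
-- i.e. the base-b representation of k written t times in a row.
repinteger : ℕ → ℕ → ℕ → ℕ
repinteger b k t = k * geomSum (b ^ numDigits b k) t

-- Write K = k (1 + B + … + B^(t-1)) with B = b^ℓ.  For every prime q some d ≥ 1 has
-- q ∣ B (1 + … + B^(d-1)) (pigeonhole on the partial sums mod q), and this persists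
-- along multiples of d; so there is M ≥ 1 such that 2 and every p j divide
-- X = B (1 + … + B^(cM-1)) for all c.  For t = 1 + cM we get K = k + k X, hence K is odd and
-- K·2ⁿ+1 ≡ k·2ⁿ+1 (mod p j) for all j: the covering that makes k·2ⁿ+1 composite
-- works verbatim for K, and K·2ⁿ+1 ≥ k·2ⁿ+1 > p j.
module Submission where

open import Defs
open import Data.Nat using (ℕ; _+_; _*_; _∸_; _^_; _≤_; _<_; _>_)
open import Data.Nat.Divisibility using (_∣_)
open import Data.Nat.Primality using (Prime)
open import Data.Integer as ℤ using (ℤ; +_)
open import Data.Integer.Divisibility as ℤD using ()
open import Data.Fin using (Fin)
open import Data.Product using (Σ; ∃; _×_)
open import Function.Definitions using (Injective)
open import Relation.Binary.PropositionalEquality using (_≡_)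

open import Data.Nat using (zero; suc; s≤s; NonZero; >-nonZero; nonTrivial⇒≢1; ∣_-_∣; _%_; _/_)
open import Data.Nat.Properties
open import Data.Nat.DivMod using (m≡m%n+[m/n]*n; m%n<n; %-remove-+ʳ)
open import Data.Nat.Divisibility
  using (divides; _∣0; ∣-refl; ∣-trans; ∣1⇒≡1; ∣m∣n⇒∣m+n; ∣m+n∣m⇒∣n; ∣m⇒∣m*n; ∣n⇒∣m*n; m∣m*n; *-monoʳ-∣)
open import Data.Nat.Divisibility.Core using (hasNonTrivialDivisor)
open import Data.Nat.Primality using (Composite; euclidsLemma; prime[2]; prime⇒nonZero; prime⇒nonTrivial)
open import Data.Nat.Tactic.RingSolver using (solve-∀)
import Data.Integer.Properties as ℤP
open import Data.Fin as Fin using (toℕ; fromℕ<)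
open import Data.Fin.Properties using (pigeonhole; toℕ-fromℕ<)
open import Data.Vec.Functional using (_∷_)
open import Data.Product using (_,_; ∃₂)
open import Data.Sum using (inj₁; inj₂)
open import Function using (_∘_; _⇔_; mk⇔; Equivalence)
open import Relation.Nullary using (contradiction)
open import Relation.Binary.PropositionalEquality using (refl; sym; trans; cong; cong₂; subst; module ≡-Reasoning)

geomSum-+ : ∀ x m n → geomSum x (m + n) ≡ geomSum x m + x ^ m * geomSum x n
geomSum-+ x m zero = begin
  geomSum x (m + 0)        ≡⟨ cong (geomSum x) (+-identityʳ m) ⟩
  geomSum x m              ≡⟨ sym (+-identityʳ _) ⟩
  geomSum x m + 0          ≡⟨ cong (_+_ (geomSum x m)) (sym (*-zeroʳ (x ^ m))) ⟩
  geomSum x m + x ^ m * 0  ∎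
  where open ≡-Reasoning
geomSum-+ x m (suc n) = begin
  geomSum x (m + suc n)                                ≡⟨ cong (geomSum x) (+-suc m n) ⟩
  geomSum x (m + n) + x ^ (m + n)                      ≡⟨ cong₂ _+_ (geomSum-+ x m n) (^-distribˡ-+-* x m n) ⟩
  geomSum x m + x ^ m * geomSum x n + x ^ m * x ^ n    ≡⟨ +-assoc (geomSum x m) _ _ ⟩
  geomSum x m + (x ^ m * geomSum x n + x ^ m * x ^ n)  ≡⟨ cong (_+_ (geomSum x m)) (sym (*-distribˡ-+ (x ^ m) _ _)) ⟩
  geomSum x m + x ^ m * (geomSum x n + x ^ n)          ∎
  where open ≡-Reasoning

geomSum-suc : ∀ x n → geomSum x (suc n) ≡ 1 + x * geomSum x n
geomSum-suc x n = trans (geomSum-+ x 1 n) (cong (λ y → 1 + y * geomSum x n) (*-identityʳ x))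

geomSum∣geomSum-* : ∀ x d c → geomSum x d ∣ geomSum x (c * d)
geomSum∣geomSum-* x d zero    = geomSum x d ∣0
geomSum∣geomSum-* x d (suc c) = subst (geomSum x d ∣_) (sym (geomSum-+ x d (c * d)))
  (∣m∣n⇒∣m+n ∣-refl (∣n⇒∣m*n (x ^ d) (geomSum∣geomSum-* x d c)))

m%n≡[m+o]%n⇒n∣o : ∀ {n} .{{_ : NonZero n}} m o → m % n ≡ (m + o) % n → n ∣ o
m%n≡[m+o]%n⇒n∣o {n} m o eq = divides ((m + o) / n ∸ m / n) (begin
  o                                          ≡⟨ sym (m+n∸m≡n m o) ⟩
  m + o ∸ m                                  ≡⟨ cong₂ _∸_ (m≡m%n+[m/n]*n (m + o) n) (m≡m%n+[m/n]*n m n) ⟩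
  (m + o) % n + (m + o) / n * n ∸ (m % n + m / n * n)
                                             ≡⟨ cong (λ r → r + (m + o) / n * n ∸ (m % n + m / n * n)) (sym eq) ⟩
  m % n + (m + o) / n * n ∸ (m % n + m / n * n) ≡⟨ [m+n]∸[m+o]≡n∸o (m % n) _ _ ⟩
  (m + o) / n * n ∸ m / n * n                ≡⟨ sym (*-distribʳ-∸ n ((m + o) / n) (m / n)) ⟩
  ((m + o) / n ∸ m / n) * n                  ∎)
  where open ≡-Reasoning

prime∣^⇒∣ : ∀ {p} x n → Prime p → p ∣ x ^ n → p ∣ x
prime∣^⇒∣ x zero    p-prime p∣1 = contradiction (∣1⇒≡1 p∣1) (nonTrivial⇒≢1 {{prime⇒nonTrivial p-prime}})
prime∣^⇒∣ x (suc n) p-prime p∣x*x^n with euclidsLemma x (x ^ n) p-prime p∣x*x^n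
... | inj₁ p∣x   = p∣x
... | inj₂ p∣x^n = prime∣^⇒∣ x n p-prime p∣x^n

residue : ∀ p .{{_ : NonZero p}} → ℕ → Fin p
residue p n = fromℕ< (m%n<n n p)

geomSum-%-collision : ∀ x p .{{_ : NonZero p}} →
  ∃₂ λ a d → 1 ≤ d × geomSum x a % p ≡ geomSum x (a + d) % p
geomSum-%-collision x p with i , j , i<j , same ← pigeonhole (n<1+n p) (residue p ∘ geomSum x ∘ toℕ) =
  toℕ i , toℕ j ∸ toℕ i , m<n⇒0<n∸m i<j , (begin
    geomSum x (toℕ i) % p                    ≡⟨ sym (toℕ-fromℕ< _) ⟩
    toℕ (residue p (geomSum x (toℕ i)))      ≡⟨ cong toℕ same ⟩
    toℕ (residue p (geomSum x (toℕ j)))      ≡⟨ toℕ-fromℕ< _ ⟩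
    geomSum x (toℕ j) % p                    ≡⟨ cong (λ n → geomSum x n % p) (sym (m+[n∸m]≡n (<⇒≤ i<j))) ⟩
    geomSum x (toℕ i + (toℕ j ∸ toℕ i)) % p  ∎)
  where open ≡-Reasoning

prime⇒∃-period : ∀ x {p} → Prime p → ∃ λ d → 1 ≤ d × p ∣ x * geomSum x d
prime⇒∃-period x {p} p-prime with a , d , d≥1 , collision ← geomSum-%-collision x p {{prime⇒nonZero p-prime}} = d , d≥1 , p∣x*S
  where
  instance _ = prime⇒nonZero p-prime
  p∣x^a*S : p ∣ x ^ a * geomSum x d
  p∣x^a*S = m%n≡[m+o]%n⇒n∣o _ _ (trans collision (cong (_% p) (geomSum-+ x a d)))
  p∣x*S : p ∣ x * geomSum x d
  p∣x*S with euclidsLemma (x ^ a) (geomSum x d) p-prime p∣x^a*S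
  ... | inj₁ p∣x^a = ∣m⇒∣m*n (geomSum x d) (prime∣^⇒∣ x a p-prime p∣x^a)
  ... | inj₂ p∣S   = ∣n⇒∣m*n x p∣S

∣x*geomSum-* : ∀ {q} x d c → q ∣ x * geomSum x d → q ∣ x * geomSum x (c * d)
∣x*geomSum-* x d c q∣ = ∣-trans q∣ (*-monoʳ-∣ x (geomSum∣geomSum-* x d c))

∃-common-period : ∀ x {τ} (q : Fin τ → ℕ) → (∀ j → Prime (q j)) →
  ∃ λ M → 1 ≤ M × (∀ j → q j ∣ x * geomSum x M)
∃-common-period x {zero}  q primes = 1 , ≤-refl , λ ()
∃-common-period x {suc τ} q primes
  with d , d≥1 , q₀∣ ← prime⇒∃-period x (primes Fin.zero)
     | M , M≥1 , qₛ∣ ← ∃-common-period x (q ∘ Fin.suc) (primes ∘ Fin.suc)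
  = d * M , *-mono-≤ d≥1 M≥1 , λ where
      Fin.zero    → subst (λ n → q Fin.zero ∣ x * geomSum x n) (*-comm M d) (∣x*geomSum-* x d M q₀∣)
      (Fin.suc j) → ∣x*geomSum-* x M d (qₛ∣ j)

geomSum-telescope : ∀ z n → z * geomSum (suc z) n + 1 ≡ suc z ^ n
geomSum-telescope z zero    = cong (_+ 1) (*-zeroʳ z)
geomSum-telescope z (suc n) = begin
  z * (geomSum y n + y ^ n) + 1      ≡⟨ regroup z (geomSum y n) (y ^ n) ⟩
  (z * geomSum y n + 1) + z * y ^ n  ≡⟨ cong (_+ z * y ^ n) (geomSum-telescope z n) ⟩
  y ^ n + z * y ^ n                  ∎
  where
  y : ℕ
  y = suc z
  regroup : ∀ a b c → a * (b + c) + 1 ≡ (a * b + 1) + a * c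
  regroup = solve-∀
  open ≡-Reasoning

m∸1∣m^n∸1 : ∀ m n → m ∸ 1 ∣ m ^ n ∸ 1
m∸1∣m^n∸1 zero    zero    = ∣-refl
m∸1∣m^n∸1 zero    (suc n) = ∣-refl
m∸1∣m^n∸1 (suc z) n       = subst (z ∣_) z*S≡ (m∣m*n (geomSum (suc z) n))
  where
  z*S≡ : z * geomSum (suc z) n ≡ suc z ^ n ∸ 1
  z*S≡ = trans (sym (m+n∸n≡m _ 1)) (cong (_∸ 1) (geomSum-telescope z n))

∣^∸1⇒∣^multiple∸1 : ∀ {p x e d} → p ∣ x ^ e ∸ 1 → e ∣ d → p ∣ x ^ d ∸ 1
∣^∸1⇒∣^multiple∸1 {p} {x} {e} p∣ (divides s refl) =
  subst (λ n → p ∣ x ^ n ∸ 1) (*-comm e s)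
    (subst (λ y → p ∣ y ∸ 1) (^-*-assoc x e s) (∣-trans p∣ (m∸1∣m^n∸1 (x ^ e) s)))

k*x^[a+e]+1≡ : ∀ k x a e .{{_ : NonZero x}} →
  k * x ^ (a + e) + 1 ≡ k * x ^ a * (x ^ e ∸ 1) + (k * x ^ a + 1)
k*x^[a+e]+1≡ k x a e = begin
  k * x ^ (a + e) + 1                        ≡⟨ cong (λ y → k * y + 1) (^-distribˡ-+-* x a e) ⟩
  k * (x ^ a * x ^ e) + 1                    ≡⟨ cong (λ y → k * (x ^ a * y) + 1) (sym (m∸n+n≡m (m^n>0 x e))) ⟩
  k * (x ^ a * (x ^ e ∸ 1 + 1)) + 1          ≡⟨ regroup k (x ^ a) (x ^ e ∸ 1) ⟩
  k * x ^ a * (x ^ e ∸ 1) + (k * x ^ a + 1)  ∎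
  where
  regroup : ∀ k y w → k * (y * (w + 1)) + 1 ≡ k * y * w + (k * y + 1)
  regroup = solve-∀
  open ≡-Reasoning

∣k*x^a+1⇔∣k*x^[a+e]+1 : ∀ {p} k x a e .{{_ : NonZero x}} → p ∣ x ^ e ∸ 1 →
  p ∣ k * x ^ a + 1 ⇔ p ∣ k * x ^ (a + e) + 1
∣k*x^a+1⇔∣k*x^[a+e]+1 {p} k x a e p∣ = mk⇔
  (λ p∣k*x^a+1 → subst (p ∣_) (sym split) (∣m∣n⇒∣m+n p∣difference p∣k*x^a+1))
  (λ p∣k*x^[a+e]+1 → ∣m+n∣m⇒∣n (subst (p ∣_) split p∣k*x^[a+e]+1) p∣difference)
  where
  split : k * x ^ (a + e) + 1 ≡ k * x ^ a * (x ^ e ∸ 1) + (k * x ^ a + 1)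
  split = k*x^[a+e]+1≡ k x a e
  p∣difference : p ∣ k * x ^ a * (x ^ e ∸ 1)
  p∣difference = ∣n⇒∣m*n (k * x ^ a) p∣

∣k*x^+1-periodic : ∀ {p e} k x .{{_ : NonZero x}} a b → p ∣ x ^ e ∸ 1 → e ∣ ∣ b - a ∣ →
  p ∣ k * x ^ a + 1 → p ∣ k * x ^ b + 1
∣k*x^+1-periodic {p} {e} k x a b p∣ e∣ with ≤-total a b
... | inj₁ a≤b = subst (λ n → p ∣ k * x ^ n + 1) (m+[n∸m]≡n a≤b)
                 ∘ Equivalence.to (∣k*x^a+1⇔∣k*x^[a+e]+1 k x a (b ∸ a) (∣^∸1⇒∣^multiple∸1 p∣ e∣b∸a))
  where
  e∣b∸a : e ∣ b ∸ a
  e∣b∸a = subst (e ∣_) (trans (∣-∣-comm b a) (m≤n⇒∣m-n∣≡n∸m a≤b)) e∣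
... | inj₂ b≤a = Equivalence.from (∣k*x^a+1⇔∣k*x^[a+e]+1 k x b (a ∸ b) (∣^∸1⇒∣^multiple∸1 p∣ e∣a∸b))
                 ∘ subst (λ n → p ∣ k * x ^ n + 1) (sym (m+[n∸m]≡n b≤a))
  where
  e∣a∸b : e ∣ a ∸ b
  e∣a∸b = subst (e ∣_) (m≤n⇒∣m-n∣≡n∸m b≤a) e∣

∣+m-+n∣≡∣m-n∣ : ∀ m n → ℤ.∣ + m ℤ.- + n ∣ ≡ ∣ m - n ∣
∣+m-+n∣≡∣m-n∣ m n with ≤-total m n
... | inj₁ m≤n = trans (cong ℤ.∣_∣ (ℤP.m-n≡m⊖n m n))
                   (trans (ℤP.∣⊖∣-≤ m≤n) (sym (m≤n⇒∣m-n∣≡n∸m m≤n)))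
... | inj₂ n≤m = trans (cong ℤ.∣_∣ (trans (ℤP.m-n≡m⊖n m n) (ℤP.⊖-≥ n≤m)))
                   (sym (trans (∣-∣-comm m n) (m≤n⇒∣m-n∣≡n∸m n≤m)))

CoveredBy : ∀ {τ} → (Fin τ → ℕ) → ℕ → Set
CoveredBy p k = ∀ n → 1 ≤ n → ∃ λ j → p j ∣ k * 2 ^ n + 1 × p j < k * 2 ^ n + 1

covering⇒coveredBy : ∀ {k τ} {r m p : Fin τ → ℕ} →
  ((a : ℤ) → ∃ λ (j : Fin τ) → (+ m j) ℤD.∣ (a ℤ.- + r j)) →
  ((j : Fin τ) → p j ∣ (2 ^ m j ∸ 1)) →
  ((j : Fin τ) → p j ∣ (k * 2 ^ r j + 1)) →
  ((j : Fin τ) (n : ℕ) → 1 ≤ n → k * 2 ^ n + 1 > p j) →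
  CoveredBy p k
covering⇒coveredBy {k} {r = r} {m} {p} cover p∣2^m∸1 p∣k*2^r+1 p< n n≥1 with cover (+ n)
... | j , m∣n-r = j , p∣k*2^n+1 , p< j n n≥1
  where
  p∣k*2^n+1 : p j ∣ k * 2 ^ n + 1
  p∣k*2^n+1 = ∣k*x^+1-periodic k 2 (r j) n (p∣2^m∸1 j) (subst (m j ∣_) (∣+m-+n∣≡∣m-n∣ n (r j)) m∣n-r) (p∣k*2^r+1 j)

coveredBy-+ : ∀ {τ} {p : Fin τ → ℕ} {k X} → (∀ j → p j ∣ X) → CoveredBy p k → CoveredBy p (k + X)
coveredBy-+ {p = p} {k} {X} p∣X covered n n≥1 with covered n n≥1
... | j , p∣ , p< = j , subst (p j ∣_) (sym split) (∣m∣n⇒∣m+n p∣ (∣m⇒∣m*n (2 ^ n) (p∣X j)))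
                      , <-≤-trans p< (subst (k * 2 ^ n + 1 ≤_) (sym split) (m≤m+n _ _))
  where
  regroup : ∀ k X y → (k + X) * y + 1 ≡ (k * y + 1) + X * y
  regroup = solve-∀
  split : (k + X) * 2 ^ n + 1 ≡ (k * 2 ^ n + 1) + X * 2 ^ n
  split = regroup k X (2 ^ n)

coveredBy⇒composite : ∀ {τ} {p : Fin τ → ℕ} {k} → (∀ j → Prime (p j)) → CoveredBy p k →
  ∀ n → 1 ≤ n → Composite (k * 2 ^ n + 1)
coveredBy⇒composite primes covered n n≥1 with covered n n≥1
... | j , p∣ , p< = hasNonTrivialDivisor {{prime⇒nonTrivial (primes j)}} p< p∣

prime-∷ : ∀ {τ q} {p : Fin τ → ℕ} → Prime q → (∀ j → Prime (p j)) → ∀ j → Prime ((q ∷ p) j)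
prime-∷ q-prime primes Fin.zero    = q-prime
prime-∷ q-prime primes (Fin.suc j) = primes j

sierpinski-+ : ∀ {τ} {p : Fin τ → ℕ} {k X} → (∀ j → Prime (p j)) → Odd k → 1 ≤ k → CoveredBy p k →
  (∀ j → (2 ∷ p) j ∣ X) → Sierpinski (k + X)
sierpinski-+ {k = k} {X} primes odd k≥1 covered q∣X =
    trans (%-remove-+ʳ k (q∣X Fin.zero)) odd
  , ≤-trans k≥1 (m≤m+n k X)
  , coveredBy⇒composite {k = k + X} primes (coveredBy-+ {k = k} {X} (q∣X ∘ Fin.suc) covered)

∃-sierpinski-k*geomSum : ∀ {τ} {p : Fin τ → ℕ} {k} → (∀ j → Prime (p j)) → Odd k → 1 ≤ k →
  CoveredBy p k → ∀ x N → Σ ℕ λ t → (t > N) × Sierpinski (k * geomSum x t)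
∃-sierpinski-k*geomSum {p = p} {k} primes odd k≥1 covered x N
  with M , M≥1 , q∣ ← ∃-common-period x (2 ∷ p) (prime-∷ prime[2] primes)
  = t , t>N , subst Sierpinski (sym k*S≡)
      (sierpinski-+ primes odd k≥1 covered (λ j → ∣n⇒∣m*n k (∣x*geomSum-* x M (suc N) (q∣ j))))
  where
  t : ℕ
  t = suc (suc N * M)
  t>N : t > N
  t>N = s≤s (≤-trans (n≤1+n N) (m≤m*n (suc N) M {{>-nonZero M≥1}}))
  X : ℕ
  X = x * geomSum x (suc N * M)
  k*S≡ : k * geomSum x t ≡ k + k * X
  k*S≡ = trans (cong (k *_) (geomSum-suc x (suc N * M))) (trans (*-distribˡ-+ k 1 X) (cong (_+ k * X) (*-identityʳ k)))

theorem3p3 : (k : ℕ) → Odd k → 1 ≤ k →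
    (τ : ℕ) (r m p : Fin τ → ℕ) →
    ((j : Fin τ) → 1 ≤ m j) →
    ((a : ℤ) → ∃ λ (j : Fin τ) → (+ m j) ℤD.∣ (a ℤ.- + r j)) →
    ((j : Fin τ) → Prime (p j)) →
    Injective _≡_ _≡_ p →
    ((j : Fin τ) → p j ∣ (2 ^ m j ∸ 1)) →
    ((j : Fin τ) → p j ∣ (k * 2 ^ r j + 1)) →
    ((j : Fin τ) (n : ℕ) → 1 ≤ n → k * 2 ^ n + 1 > p j) →
    (b : ℕ) → 2 ≤ b →
    (N : ℕ) → Σ ℕ λ t → (t > N) × Sierpinski (repinteger b k t)
theorem3p3 k odd k≥1 τ r m p _ cover primes _ p∣2^m∸1 p∣k*2^r+1 p< b _ =
  ∃-sierpinski-k*geomSum {k = k} primes odd k≥1 (covering⇒coveredBy {k} cover p∣2^m∸1 p∣k*2^r+1 p<) (b ^ numDigits b k)
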